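{- Let $G=(V,E)$ be a connected finite undirected graph and $p$ an integer with $2\le p\le|V|$. Then $G$ is universally solvable for $p$ robots if and only if, for every $t\in[p-1]$, the configuration $S_{\pi^*_t}$ is reachable from the identity configuration $S_I$, where $\pi^*_t:[p]\to[p]$ is the transposition with $\pi^*_t(t)=t+1$, $\pi^*_t(t+1)=t$ and $\pi^*_t(i)=i$ otherwise, and $S_{\pi}(i)=v_{\pi(i)}$.
   Context: Robots are $R=[p]=\{1,\dots,p\}$. A configuration is an injective map $S:R\to V$. A pair $(S,S')$ of configurations is a valid move if it is one of: (i) a simple path move: there is a simple path $(u_0,\dots,u_k)$ in $G$ with $u_k\notin S(R)$, $u_0\notin S'(R)$, $S'(i)=S(i)$ for robots not on the path, and $S'(i)=u_{j+1}$ whenever $S(i)=u_j$, $0\le j\le k-1$; (ii) a simple rotation move: there is a simple cycle $(u_0,\dots,u_{k-1},u_k=u_0)$ in $G$ all of whose vertices are occupied in $S$ and in $S'$, robots off the cycle stay fixed, and $S'(i)=u_{j+1}$ whenever $S(i)=u_j$; (iii) a dummy move $(S,S)$. $T$ is reachable from $S$ if there is a finite sequence $S=S_0,\dots,S_t=T$ with each $(S_{k-1},S_k)$ a valid move. $G$ is universally solvable for $p$ robots if every configuration is reachable from every other. Fix a total order on $V$ and let $v_1,\dots,v_n$ be the order in which breadth-first search, started at the least vertex and exploring neighbours in increasing order, visits the vertices of $G$. The identity configuration is $S_I(i)=v_i$, $i\in[p]$, and for a permutation $\pi$ of $[p]$, $S_\pi=S_I\circ\pi$. -}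

module Defs where

open import Data.Nat using (ℕ; zero; suc; _≤_; _<_)
open import Data.Nat.DivMod using (_%_; m%n<n)
open import Data.Nat.Properties using (≤-trans)
open import Data.Bool using (Bool; true; false; _∧_; not)
open import Data.Fin using (Fin; toℕ; fromℕ; fromℕ<; inject₁; inject≤; _≟_)
open import Data.Fin.Properties using (toℕ<n)
open import Data.List using (List; []; _∷_; _++_; filter; allFin)
open import Data.Bool.ListAction using (any)
open import Data.Product using (Σ; ∃; _×_; _,_)
open import Function.Definitions using (Injective)
open import Relation.Binary.PropositionalEquality using (_≡_; _≢_)
open import Relation.Binary.Construct.Closure.ReflexiveTransitive using (Star)
open import Relation.Nullary using (⌊_⌋)
open import Relation.Unary using (Pred)

-- A finite simple undirected graph on the vertex set Fin n,
-- the total order on vertices being the natural order of Fin n.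
record Graph (n : ℕ) : Set where
  field
    adj     : Fin n → Fin n → Bool
    adj-sym : ∀ u v → adj u v ≡ adj v u
    adj-irr : ∀ v → adj v v ≡ false

module _ {n : ℕ} (G : Graph n) where
  open Graph G

  Adj : Fin n → Fin n → Set
  Adj u v = adj u v ≡ true

  data Walk : Fin n → Fin n → Set where
    here : ∀ {v} → Walk v v
    step : ∀ {u v w} → Adj u v → Walk v w → Walk u w

  Connected : Set
  Connected = ∀ u v → Walk u v

  -- Breadth-first search from the least vertex, neighbours in increasing order

  _∈ᵇ_ : Fin n → List (Fin n) → Bool
  v ∈ᵇ vis = any (λ w → ⌊ w ≟ v ⌋) vis

  newNbrs : Fin n → List (Fin n) → List (Fin n)
  newNbrs u vis = filter (λ v → adj u v ∧ not (v ∈ᵇ vis) ≟ᵇ true) (allFin n)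
    where
      open import Data.Bool using () renaming (_≟_ to _≟ᵇ_)

  -- fuel, queue, visited vertices in visiting order
  bfsLoop : ℕ → List (Fin n) → List (Fin n) → List (Fin n)
  bfsLoop zero    q       vis = vis
  bfsLoop (suc f) []      vis = vis
  bfsLoop (suc f) (u ∷ q) vis = bfsLoop f (q ++ new) (vis ++ new)
    where new = newNbrs u vis

  -- the BFS visiting order v₁, v₂, … (every vertex is dequeued at most once,
  -- so n rounds of fuel suffice)
  bfsFrom : List (Fin n) → List (Fin n)
  bfsFrom []      = []
  bfsFrom (v ∷ _) = bfsLoop n (v ∷ []) (v ∷ [])

  -- allFin n lists the vertices increasingly, so its head is the least vertex
  bfsOrder : List (Fin n)
  bfsOrder = bfsFrom (allFin n)

  -- Configurations (raw maps robots → vertices; injectivity imposed where needed)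

  Conf : ℕ → Set
  Conf p = Fin p → Fin n

  PathMove : ∀ {p} → Conf p → Conf p → Set
  PathMove {p} S S' =
    Σ ℕ λ k → Σ (Fin (suc k) → Fin n) λ u →
      Injective _≡_ _≡_ u
    × (∀ (j : Fin k) → Adj (u (inject₁ j)) (u (Fin.suc j)))
    × (∀ i → S i ≢ u (fromℕ k))
    × (∀ i → S' i ≢ u Fin.zero)
    × (∀ i → (∀ j → S i ≢ u j) → S' i ≡ S i)
    × (∀ i (j : Fin k) → S i ≡ u (inject₁ j) → S' i ≡ u (Fin.suc j))

  cnext : ∀ {m} → Fin (suc m) → Fin (suc m)
  cnext {m} j = fromℕ< (m%n<n (suc (toℕ j)) (suc m))

  RotMove : ∀ {p} → Conf p → Conf p → Set
  RotMove {p} S S' =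
    Σ ℕ λ m → Σ (Fin (suc (suc (suc m))) → Fin n) λ u →
      Injective _≡_ _≡_ u
    × (∀ j → Adj (u j) (u (cnext j)))
    × (∀ j → ∃ λ i → S i ≡ u j)
    × (∀ j → ∃ λ i → S' i ≡ u j)
    × (∀ i → (∀ j → S i ≢ u j) → S' i ≡ S i)
    × (∀ i j → S i ≡ u j → S' i ≡ u (cnext j))

  data ValidMove {p} (S S' : Conf p) : Set where
    path  : PathMove S S' → ValidMove S S'
    rot   : RotMove S S' → ValidMove S S'
    dummy : S ≡ S' → ValidMove S S'

  Reachable : ∀ {p} → Conf p → Conf p → Set
  Reachable S T = Star ValidMove S T

  UniversallySolvable : ℕ → Set
  UniversallySolvable p =
    (S T : Conf p) → Injective _≡_ _≡_ S → Injective _≡_ _≡_ T → Reachable S T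

  nthOr : List (Fin n) → ℕ → Fin n → Fin n
  nthOr []       _       d = d
  nthOr (x ∷ _)  zero    d = x
  nthOr (_ ∷ xs) (suc k) d = nthOr xs k d

  -- identity configuration: robot i (0-based here) sits on the BFS vertex v_{i+1};
  -- the default is never used when G is connected (bfsOrder then has length n ≥ p)
  S-I : ∀ {p} → p ≤ n → Conf p
  S-I p≤n i = nthOr bfsOrder (toℕ i) (inject≤ i p≤n)

  S-π : ∀ {p} → p ≤ n → (Fin p → Fin p) → Conf p
  S-π p≤n π i = S-I p≤n (π i)

{-# OPTIONS --safe #-}
-- BFS lists every vertex of a connected graph exactly once, so S_I and all S_π are
-- injective, which gives necessity. For sufficiency, every injective configuration S can be
-- rearranged reversibly so that it occupies v₁, …, v_p: a robot off these vertices is walked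
-- to a free one, and whenever the walk meets an occupied vertex, that vertex's robot is sent
-- ahead first. The result is S_I ∘ σ for a permutation σ. Relabelling the move sequences
-- from S_I to S_I ∘ π*_t by σ makes S_I ∘ σ and S_I ∘ π*_t ∘ σ mutually reachable, and
-- bubble sort by adjacent transpositions connects S_I ∘ σ to S_I.
module Submission where

open import Defs
open import Data.Bool using (true; _∧_; not)
open import Data.Bool.Properties using (¬-not; ∧-zeroʳ)
open import Data.Fin using (Fin; toℕ; fromℕ<; inject₁; punchOut; _≟_) renaming (zero to fzero; suc to fsuc)
open import Data.Fin.Permutation.Components using (transpose; transpose-inverse)
open import Data.Fin.Properties using (any?; toℕ<n; toℕ-injective; toℕ-fromℕ<; injective⇒≤; punchOut-injective; ¬∀⟶∃¬)
open import Data.Vec.Functional using (updateAt)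
open import Data.Vec.Functional.Properties using (updateAt-updates; updateAt-minimal)
open import Data.List using (List; []; _∷_; _++_; length; lookup; allFin; tabulate)
open import Data.List.Membership.Propositional using (_∈_; _∉_)
open import Data.List.Membership.Propositional.Properties using (∈-++⁺ˡ; ∈-++⁺ʳ; ∈-++⁻; ∈-filter⁺; ∈-filter⁻; ∈-allFin; ∈-tabulate⁺)
open import Data.List.Properties using (length-++; length-tabulate)
open import Data.List.Relation.Unary.All as All using ()
open import Data.List.Relation.Unary.AllPairs using ([]; _∷_)
open import Data.List.Relation.Unary.Any using (here; there; index)
open import Data.List.Relation.Unary.Any.Properties using (lookup-index)
open import Data.List.Relation.Unary.Unique.Propositional using (Unique)
import Data.List.Relation.Unary.Unique.Propositional.Properties as Unique
open import Data.Nat using (ℕ; zero; suc; _+_; _∸_; _≤_; _<_; z≤n; s≤s; s≤s⁻¹; _≤?_)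
open import Data.Nat.Properties
  using (≤-refl; ≤-reflexive; ≤-trans; <⇒≤; <-≤-trans; ≰⇒>; m≤n⇒m<n∨m≡n; <⇒≢; <-irrefl; 0≢1+n;
         m≤m+n; m≤n+m; +-suc; +-assoc; +-identityʳ; +-monoˡ-≤; m+[n∸m]≡n; module ≤-Reasoning)
open import Data.Product using (∃; _×_; _,_; proj₁; proj₂)
open import Data.Sum as Sum using (_⊎_; inj₁; inj₂)
open import Function using (_∘_; id; const)
open import Function.Bundles using (_⇔_; mk⇔; Equivalence)
open import Function.Properties.Equivalence using () renaming (trans to ⇔-trans)
open import Function.Definitions using (Injective; StrictlySurjective)
open import Relation.Binary.Definitions using (DecidableEquality)
open import Relation.Binary.PropositionalEquality using (_≡_; _≢_; _≗_; refl; sym; trans; cong; subst; module ≡-Reasoning)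
open import Relation.Binary.Construct.Closure.ReflexiveTransitive as Star using (Star; ε; _◅_; _◅◅_)
open import Relation.Nullary using (¬_; Dec; yes; no; contradiction)

transpose-matchˡ : ∀ {p} (i j : Fin p) → transpose i j i ≡ j
transpose-matchˡ i j with i ≟ i
... | yes _   = refl
... | no i≢i = contradiction refl i≢i

transpose-matchʳ : ∀ {p} (i j : Fin p) → transpose i j j ≡ i
transpose-matchʳ i j with j ≟ i
... | yes j≡i = j≡i
... | no _ with j ≟ j
...   | yes _   = refl
...   | no j≢j = contradiction refl j≢j

transpose-other : ∀ {p} {i j k : Fin p} → k ≢ i → k ≢ j → transpose i j k ≡ k
transpose-other {i = i} {j} {k} k≢i k≢j with k ≟ i
... | yes k≡i = contradiction k≡i k≢i
... | no _ with k ≟ j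
...   | yes k≡j = contradiction k≡j k≢j
...   | no _    = refl

transpose-involutive : ∀ {p} (i j k : Fin p) → transpose i j (transpose i j k) ≡ k
transpose-involutive i j k = by-cases (k ≟ i) (k ≟ j)
  where
    open ≡-Reasoning

    twice : Fin _ → Fin _
    twice x = transpose i j (transpose i j x)

    by-cases : Dec (k ≡ i) → Dec (k ≡ j) → twice k ≡ k
    by-cases (yes k≡i) _ = begin
      twice k                ≡⟨ cong twice k≡i ⟩
      transpose i j (transpose i j i) ≡⟨ cong (transpose i j) (transpose-matchˡ i j) ⟩
      transpose i j j        ≡⟨ transpose-matchʳ i j ⟩
      i                      ≡⟨ sym k≡i ⟩
      k                      ∎
    by-cases (no _) (yes k≡j) = begin
      twice k                ≡⟨ cong twice k≡j ⟩
      transpose i j (transpose i j j) ≡⟨ cong (transpose i j) (transpose-matchʳ i j) ⟩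
      transpose i j i        ≡⟨ transpose-matchˡ i j ⟩
      j                      ≡⟨ sym k≡j ⟩
      k                      ∎
    by-cases (no k≢i) (no k≢j) =
      trans (cong (transpose i j) (transpose-other k≢i k≢j)) (transpose-other k≢i k≢j)

transpose-injective : ∀ {p} (i j : Fin p) → Injective _≡_ _≡_ (transpose i j)
transpose-injective i j {k} {l} eq =
  trans (sym (transpose-inverse j i)) (trans (cong (transpose j i) eq) (transpose-inverse j i))

module _ {A : Set} where

  all∈⇒≤length : ∀ {m} {f : Fin m → A} {xs : List A} →
                 Injective _≡_ _≡_ f → (∀ i → f i ∈ xs) → m ≤ length xs
  all∈⇒≤length {f = f} {xs} f-inj f∈ = injective⇒≤ position-injective
    where
      position-injective : Injective _≡_ _≡_ (λ i → index (f∈ i))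
      position-injective {i} {j} eq =
        f-inj (trans (lookup-index (f∈ i)) (trans (cong (lookup xs) eq) (sym (lookup-index (f∈ j)))))

  ∃-image-∉ : DecidableEquality A → ∀ {m} {f : Fin m → A} {xs : List A} →
              Injective _≡_ _≡_ f → length xs < m → ∃ λ i → f i ∉ xs
  ∃-image-∉ _≟ᴬ_ {m} {f} {xs} f-inj xs<m =
    ¬∀⟶∃¬ m (λ i → f i ∈ xs) (λ i → f i ∈? xs)
      (λ f∈ → <-irrefl refl (<-≤-trans xs<m (all∈⇒≤length f-inj f∈)))
    where open import Data.List.Membership.DecPropositional _≟ᴬ_ using (_∈?_)

injective⇒strictlySurjective : ∀ {m} {f : Fin m → Fin m} →
                               Injective _≡_ _≡_ f → StrictlySurjective _≡_ f
injective⇒strictlySurjective {suc m} {f} f-inj y with any? (λ x → f x ≟ y)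
... | yes hit = hit
... | no miss = contradiction (injective⇒≤ punched-injective) (<-irrefl refl)
  where
    punched : Fin (suc m) → Fin m
    punched x = punchOut (λ y≡fx → miss (x , sym y≡fx))

    punched-injective : Injective _≡_ _≡_ punched
    punched-injective {x} {x'} eq =
      f-inj (punchOut-injective {i = y} (λ e → miss (x , sym e)) (λ e → miss (x' , sym e)) eq)

FixesBelow : ∀ {p} → ℕ → (Fin p → Fin p) → Set
FixesBelow k σ = ∀ i → toℕ i < k → σ i ≡ i

module _ {p : ℕ} {σ : Fin p → Fin p} {k : ℕ} where

  fixesBelow⇒≤ : Injective _≡_ _≡_ σ → FixesBelow k σ → ∀ {j} → toℕ j ≡ k → k ≤ toℕ (σ j)
  fixesBelow⇒≤ σ-inj σ-fix {j} j≡k with k ≤? toℕ (σ j)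
  ... | yes k≤σj = k≤σj
  ... | no k≰σj  = contradiction (trans (cong toℕ (σ-inj (σ-fix (σ j) σj<k))) j≡k) (<⇒≢ σj<k)
    where
      σj<k : toℕ (σ j) < k
      σj<k = ≰⇒> k≰σj

  fixesBelow-suc : FixesBelow k σ → ∀ {j} → toℕ j ≡ k → σ j ≡ j → FixesBelow (suc k) σ
  fixesBelow-suc σ-fix {j} j≡k σj≡j i (s≤s i≤k) with m≤n⇒m<n∨m≡n i≤k
  ... | inj₁ i<k = σ-fix i i<k
  ... | inj₂ i≡k = subst (λ i → σ i ≡ i) (toℕ-injective (trans j≡k (sym i≡k))) σj≡j

  fixesBelow-transpose : FixesBelow k σ → ∀ {t m} → k ≤ toℕ t → k ≤ toℕ m →
                         FixesBelow k (transpose t m ∘ σ)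
  fixesBelow-transpose σ-fix k≤t k≤m i i<k =
    trans (cong (transpose _ _) (σ-fix i i<k)) (transpose-other (below k≤t) (below k≤m))
    where
      below : ∀ {l} → k ≤ toℕ l → i ≢ l
      below k≤l i≡l = <⇒≢ (<-≤-trans i<k k≤l) (cong toℕ i≡l)

module _ {p : ℕ} (Q : (Fin p → Fin p) → Set)
         (Q-id : ∀ {σ} → σ ≗ id → Q σ)
         (Q-swap : ∀ {σ} → Injective _≡_ _≡_ σ → ∀ t t+1 → toℕ t+1 ≡ suc (toℕ t) →
                   Q (transpose t t+1 ∘ σ) → Q σ) where

  -- bubble sort: the value at position k is lowered to k by adjacent transpositions,
  -- after which σ fixes everything below k + 1
  private
    sorted-from : ∀ d k → d + k ≡ p → ∀ {σ} → Injective _≡_ _≡_ σ → FixesBelow k σ → Q σ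
    sorted-from zero k k≡p _ σ-fix =
      Q-id (λ i → σ-fix i (subst (toℕ i <_) (sym k≡p) (toℕ<n i)))
    sorted-from (suc d) k 1+d+k≡p {σ} σ-inj σ-fix =
      lower (toℕ (σ k̂) ∸ k) σ-inj σ-fix (sym (m+[n∸m]≡n (fixesBelow⇒≤ σ-inj σ-fix k̂≡k)))
      where
        k<p : k < p
        k<p = subst (k <_) 1+d+k≡p (s≤s (m≤n+m k d))

        k̂ : Fin p
        k̂ = fromℕ< k<p

        k̂≡k : toℕ k̂ ≡ k
        k̂≡k = toℕ-fromℕ< k<p

        lower : ∀ e {σ} → Injective _≡_ _≡_ σ → FixesBelow k σ → toℕ (σ k̂) ≡ k + e → Q σ
        lower zero {σ} σ-inj σ-fix σk̂≡k+0 =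
          sorted-from d (suc k) (trans (+-suc d k) 1+d+k≡p) σ-inj (fixesBelow-suc σ-fix k̂≡k σk̂≡k̂)
          where
            σk̂≡k̂ : σ k̂ ≡ k̂
            σk̂≡k̂ = toℕ-injective (trans σk̂≡k+0 (trans (+-identityʳ k) (sym k̂≡k)))
        lower (suc e) {σ} σ-inj σ-fix σk̂≡k+1+e =
          Q-swap σ-inj t m m≡1+t
            (lower e (σ-inj ∘ transpose-injective t m)
                   (fixesBelow-transpose σ-fix k≤t (subst (k ≤_) (sym σk̂≡k+1+e) (m≤m+n k (suc e))))
                   (trans (cong toℕ (transpose-matchʳ t m)) t≡k+e))
          where
            m : Fin p
            m = σ k̂

            k+e<p : k + e < p
            k+e<p = <⇒≤ (subst (_< p) (trans σk̂≡k+1+e (+-suc k e)) (toℕ<n m))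

            t : Fin p
            t = fromℕ< k+e<p

            t≡k+e : toℕ t ≡ k + e
            t≡k+e = toℕ-fromℕ< k+e<p

            k≤t : k ≤ toℕ t
            k≤t = subst (k ≤_) (sym t≡k+e) (m≤m+n k e)

            m≡1+t : toℕ m ≡ suc (toℕ t)
            m≡1+t = trans σk̂≡k+1+e (trans (+-suc k e) (cong suc (sym t≡k+e)))

  adjacentTransposition-induction : ∀ {σ} → Injective _≡_ _≡_ σ → Q σ
  adjacentTransposition-induction σ-inj = sorted-from p 0 (+-identityʳ p) σ-inj (λ _ ())

module _ {n : ℕ} (G : Graph n) where
  open Graph G
  open import Data.List.Membership.DecPropositional (_≟_ {n = n}) using (_∈?_)

  walk-closed : ∀ {P : Fin n → Set} → (∀ {v w} → P v → Adj G v w → P w) →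
                ∀ {a b} → Walk G a b → P a → P b
  walk-closed closed here          Pa = Pa
  walk-closed closed (step a~v av) Pa = walk-closed closed av (closed Pa a~v)

  ∈ᵇ⇒∈ : ∀ {v} vis → _∈ᵇ_ G v vis ≡ true → v ∈ vis
  ∈ᵇ⇒∈ {v} (w ∷ vis) eq with w ≟ v
  ... | yes refl = here refl
  ... | no _     = there (∈ᵇ⇒∈ vis eq)

  ∈⇒∈ᵇ : ∀ {v vis} → v ∈ vis → _∈ᵇ_ G v vis ≡ true
  ∈⇒∈ᵇ {v} {w ∷ vis} v∈ with w ≟ v | v∈
  ... | yes _   | _           = refl
  ... | no w≢v  | here v≡w    = contradiction (sym v≡w) w≢v
  ... | no _    | there v∈vis = ∈⇒∈ᵇ v∈vis

  ∈-newNbrs⁻ : ∀ {u vis w} → w ∈ newNbrs G u vis → w ∉ vis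
  ∈-newNbrs⁻ {u} {vis} {w} w∈new w∈vis
    with _ , condition ← ∈-filter⁻ _ {xs = allFin n} w∈new
    rewrite ∈⇒∈ᵇ w∈vis | ∧-zeroʳ (adj u w) = contradiction condition λ ()

  ∈-newNbrs⁺ : ∀ {u vis w} → Adj G u w → w ∉ vis → w ∈ newNbrs G u vis
  ∈-newNbrs⁺ {u} {vis} {w} u~w w∉vis = ∈-filter⁺ _ (∈-allFin w) condition
    where
      condition : (adj u w ∧ not (_∈ᵇ_ G w vis)) ≡ true
      condition rewrite u~w | ¬-not (w∉vis ∘ ∈ᵇ⇒∈ vis) = refl

  bfsLoop-unique : ∀ f q vis → Unique vis → Unique (bfsLoop G f q vis)
  bfsLoop-unique zero    q       vis vis-unique = vis-unique
  bfsLoop-unique (suc f) []      vis vis-unique = vis-unique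
  bfsLoop-unique (suc f) (u ∷ q) vis vis-unique =
    bfsLoop-unique f _ _ (Unique.++⁺ vis-unique new-unique λ (w∈vis , w∈new) → ∈-newNbrs⁻ w∈new w∈vis)
    where
      new-unique : Unique (newNbrs G u vis)
      new-unique = Unique.filter⁺ _ (Unique.allFin⁺ n)

  record BfsInvariant (root : Fin n) (f : ℕ) (q vis : List (Fin n)) : Set where
    field
      root-visited : root ∈ vis
      closed       : ∀ {v w} → v ∈ vis → v ∉ q → Adj G v w → w ∈ vis
      -- unvisited vertices plus queued ones never outnumber the remaining rounds
      fuel-bound   : n + length q ≤ f + length vis

  bfsInvariant-step : ∀ {root f u q vis} → BfsInvariant root (suc f) (u ∷ q) vis →
                      BfsInvariant root f (q ++ newNbrs G u vis) (vis ++ newNbrs G u vis)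
  bfsInvariant-step {root} {f} {u} {q} {vis} I = record
    { root-visited = ∈-++⁺ˡ (root-visited I)
    ; closed       = closed′
    ; fuel-bound   = fuel-bound′
    }
    where
      open BfsInvariant

      new : List (Fin n)
      new = newNbrs G u vis

      closed′ : ∀ {v w} → v ∈ vis ++ new → v ∉ q ++ new → Adj G v w → w ∈ vis ++ new
      closed′ {v} {w} v∈ v∉ v~w with ∈-++⁻ vis v∈
      ... | inj₂ v∈new = contradiction (∈-++⁺ʳ q v∈new) v∉
      ... | inj₁ v∈vis with v ≟ u
      ...   | no v≢u = ∈-++⁺ˡ (closed I v∈vis v∉u∷q v~w)
        where
          v∉u∷q : v ∉ u ∷ q
          v∉u∷q (here v≡u)   = v≢u v≡u
          v∉u∷q (there v∈q) = v∉ (∈-++⁺ˡ v∈q)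
      ...   | yes refl with w ∈? vis
      ...     | yes w∈vis = ∈-++⁺ˡ w∈vis
      ...     | no w∉vis  = ∈-++⁺ʳ vis (∈-newNbrs⁺ v~w w∉vis)

      fuel-bound′ : n + length (q ++ new) ≤ f + length (vis ++ new)
      fuel-bound′ = begin
        n + length (q ++ new)          ≡⟨ cong (n +_) (length-++ q) ⟩
        n + (length q + length new)    ≡⟨ +-assoc n _ _ ⟨
        n + length q + length new      ≤⟨ +-monoˡ-≤ (length new) dequeued ⟩
        f + length vis + length new    ≡⟨ +-assoc f _ _ ⟩
        f + (length vis + length new)  ≡⟨ cong (f +_) (length-++ vis) ⟨
        f + length (vis ++ new)        ∎
        where
          open ≤-Reasoning
          dequeued : n + length q ≤ f + length vis
          dequeued = s≤s⁻¹ (subst (_≤ suc f + length vis) (+-suc n (length q)) (fuel-bound I))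

  bfsLoop-length : Connected G → ∀ {root} f q vis → BfsInvariant root f q vis →
                   n ≤ length (bfsLoop G f q vis)
  bfsLoop-length conn zero    q       vis I = ≤-trans (m≤m+n n (length q)) (BfsInvariant.fuel-bound I)
  bfsLoop-length conn {root} (suc f) [] vis I = all∈⇒≤length id visited
    where
      open BfsInvariant I
      visited : ∀ v → v ∈ vis
      visited v = walk-closed (λ u∈ u~w → closed u∈ (λ ()) u~w) (conn root v) root-visited
  bfsLoop-length conn (suc f) (u ∷ q) vis I = bfsLoop-length conn f _ _ (bfsInvariant-step I)

  bfsFrom-unique : ∀ xs → Unique (bfsFrom G xs)
  bfsFrom-unique []      = []
  bfsFrom-unique (v ∷ _) = bfsLoop-unique n _ _ (All.[] ∷ [])

  bfsFrom-length : Connected G → ∀ xs → length xs ≡ n → n ≤ length (bfsFrom G xs)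
  bfsFrom-length conn []      0≡n = subst (_≤ 0) 0≡n z≤n
  bfsFrom-length conn (v ∷ _) _   = bfsLoop-length conn n _ _ initial
    where
      initial : BfsInvariant v n (v ∷ []) (v ∷ [])
      initial = record
        { root-visited = here refl
        ; closed       = λ v∈ v∉ _ → contradiction v∈ v∉
        ; fuel-bound   = ≤-refl
        }

  nthOr-∈ : ∀ {xs k} d → k < length xs → nthOr G xs k d ∈ xs
  nthOr-∈ {x ∷ xs} {zero}  d _         = here refl
  nthOr-∈ {x ∷ xs} {suc k} d (s≤s k<) = there (nthOr-∈ d k<)

  nthOr-injective : ∀ {xs} → Unique xs → ∀ {k k′ d d′} → k < length xs → k′ < length xs →
                    nthOr G xs k d ≡ nthOr G xs k′ d′ → k ≡ k′
  nthOr-injective {x ∷ xs} _ {zero} {zero} _ _ _ = refl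
  nthOr-injective {x ∷ xs} (x∉xs ∷ _) {zero} {suc k′} {d′ = d′} _ (s≤s k′<) x≡ =
    contradiction x≡ (All.lookup x∉xs (nthOr-∈ d′ k′<))
  nthOr-injective {x ∷ xs} (x∉xs ∷ _) {suc k} {zero} {d} (s≤s k<) _ ≡x =
    contradiction (sym ≡x) (All.lookup x∉xs (nthOr-∈ d k<))
  nthOr-injective {x ∷ xs} (_ ∷ xs-unique) {suc k} {suc k′} (s≤s k<) (s≤s k′<) eq =
    cong suc (nthOr-injective xs-unique k< k′< eq)

  S-I-injective : Connected G → ∀ {p} (p≤n : p ≤ n) → Injective _≡_ _≡_ (S-I G p≤n)
  S-I-injective conn p≤n eq = toℕ-injective (nthOr-injective (bfsFrom-unique (allFin n)) (bound _) (bound _) eq)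
    where
      bound : ∀ i → toℕ i < length (bfsOrder G)
      bound i = <-≤-trans (toℕ<n i) (≤-trans p≤n (bfsFrom-length conn (allFin n) (length-tabulate id)))

  adj⇒≢ : ∀ {a c} → Adj G a c → a ≢ c
  adj⇒≢ {a} a~a refl = contradiction (trans (sym a~a) (adj-irr a)) λ ()

  module _ {p : ℕ} where

    Occupied : Conf G p → Fin n → Set
    Occupied S v = ∃ λ i → S i ≡ v

    occupied? : ∀ S v → Dec (Occupied S v)
    occupied? S v = any? (λ i → S i ≟ v)

    occupied⇒≢ : ∀ {S a b} → Occupied S a → ¬ Occupied S b → a ≢ b
    occupied⇒≢ {S} occ-a free-b a≡b = free-b (subst (Occupied S) a≡b occ-a)

    PathMove-resp : ∀ {X X′ Y Y′ : Conf G p} → X ≗ X′ → Y ≗ Y′ → PathMove G X Y → PathMove G X′ Y′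
    PathMove-resp X≗ Y≗ (k , u , u-inj , u-adj , end-free , start-free , off , on) =
      k , u , u-inj , u-adj
        , (λ i → end-free i ∘ trans (X≗ i))
        , (λ i → start-free i ∘ trans (Y≗ i))
        , (λ i off′ → trans (sym (Y≗ i)) (trans (off i (λ j → off′ j ∘ trans (sym (X≗ i)))) (X≗ i)))
        , (λ i j on′ → trans (sym (Y≗ i)) (on i j (trans (X≗ i) on′)))

    RotMove-resp : ∀ {X X′ Y Y′ : Conf G p} → X ≗ X′ → Y ≗ Y′ → RotMove G X Y → RotMove G X′ Y′
    RotMove-resp X≗ Y≗ (k , u , u-inj , u-adj , full , full′ , off , on) =
      k , u , u-inj , u-adj
        , (λ j → let i , e = full j in i , trans (sym (X≗ i)) e)
        , (λ j → let i , e = full′ j in i , trans (sym (Y≗ i)) e)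
        , (λ i off′ → trans (sym (Y≗ i)) (trans (off i (λ j → off′ j ∘ trans (sym (X≗ i)))) (X≗ i)))
        , (λ i j on′ → trans (sym (Y≗ i)) (on i j (trans (X≗ i) on′)))

    ValidMove-resp : ∀ {X X′ Y′ Y : Conf G p} → X ≗ X′ → ValidMove G X′ Y′ → Y′ ≗ Y → X ≗ Y ⊎ ValidMove G X Y
    ValidMove-resp X≗ (path m)     ≗Y = inj₂ (path (PathMove-resp (sym ∘ X≗) ≗Y m))
    ValidMove-resp X≗ (rot m)      ≗Y = inj₂ (rot (RotMove-resp (sym ∘ X≗) ≗Y m))
    ValidMove-resp X≗ (dummy refl) ≗Y = inj₁ (λ i → trans (X≗ i) (≗Y i))

    ValidMove-relabel : ∀ {σ : Fin p → Fin p} → StrictlySurjective _≡_ σ →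
                        ∀ {X Y : Conf G p} → ValidMove G X Y → ValidMove G (X ∘ σ) (Y ∘ σ)
    ValidMove-relabel {σ} _ (path (k , u , u-inj , u-adj , end-free , start-free , off , on)) =
      path (k , u , u-inj , u-adj , end-free ∘ σ , start-free ∘ σ , off ∘ σ , on ∘ σ)
    ValidMove-relabel {σ} σ-surj {X} {Y} (rot (k , u , u-inj , u-adj , full , full′ , off , on)) =
      rot (k , u , u-inj , u-adj , pull X ∘ full , pull Y ∘ full′ , off ∘ σ , on ∘ σ)
      where
        pull : ∀ Z {v} → (∃ λ i → Z i ≡ v) → ∃ λ i → Z (σ i) ≡ v
        pull Z (i , Zi≡v) = let i′ , σi′≡i = σ-surj i in i′ , trans (cong Z σi′≡i) Zi≡v
    ValidMove-relabel _ (dummy refl) = dummy refl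

    -- Configurations are functions and there is no function extensionality, so reachability
    -- is developed up to pointwise equality; ⇝-sound turns it back into move sequences.
    infix 4 _⇝_ _⇌_

    _⇝_ : Conf G p → Conf G p → Set
    _⇝_ = Star (λ X Y → X ≗ Y ⊎ ValidMove G X Y)

    ≗⇒⇝ : ∀ {X Y} → X ≗ Y → X ⇝ Y
    ≗⇒⇝ X≗Y = inj₁ X≗Y ◅ ε

    reachable⇒⇝ : ∀ {X Y} → Reachable G X Y → X ⇝ Y
    reachable⇒⇝ = Star.map inj₂

    ⇝-relabel : ∀ {σ : Fin p → Fin p} → StrictlySurjective _≡_ σ → ∀ {X Y} → X ⇝ Y → X ∘ σ ⇝ Y ∘ σ
    ⇝-relabel {σ} σ-surj = Star.gmap (_∘ σ) (Sum.map (λ X≗Y → X≗Y ∘ σ) (ValidMove-relabel σ-surj))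

    ⇝-sound : ∀ {X Y} → X ⇝ Y → X ≗ Y ⊎ Reachable G X Y
    ⇝-sound = sound (λ _ → refl)
      where
        sound : ∀ {X X′ Y} → X ≗ X′ → X′ ⇝ Y → X ≗ Y ⊎ Reachable G X Y
        sound X≗ ε = inj₁ X≗
        sound X≗ (inj₁ X′≗ ◅ r) = sound (λ i → trans (X≗ i) (X′≗ i)) r
        sound X≗ (inj₂ m ◅ r) with ValidMove-resp X≗ m (λ _ → refl)
        ... | inj₁ X≗Y′ = sound X≗Y′ r
        ... | inj₂ m′ with sound (λ _ → refl) r
        ...   | inj₂ r′   = inj₂ (m′ ◅ r′)
        ...   | inj₁ Y′≗Y = Sum.map₂ (_◅ ε) (ValidMove-resp (λ _ → refl) m′ Y′≗Y)

    ⇝⇒reachable : ∀ {X Y} → X ⇝ Y → ¬ X ≗ Y → Reachable G X Y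
    ⇝⇒reachable X⇝Y X≉Y = Sum.[ (λ X≗Y → contradiction X≗Y X≉Y) , id ]′ (⇝-sound X⇝Y)

    -- Pointwise equal configurations need not be equal, so no dummy move joins them; we
    -- detour through S with its first two robots swapped, which is where p ≥ 2 is needed.
    ⇝-connected⇒universallySolvable : 2 ≤ p →
      (∀ {S T} → Injective _≡_ _≡_ S → Injective _≡_ _≡_ T → S ⇝ T) → UniversallySolvable G p
    ⇝-connected⇒universallySolvable 2≤p connected S T S-inj T-inj =
      Sum.[ via-T , via-W ]′ (⇝-sound (connected W-inj T-inj))
      where
        r₀ r₁ : Fin p
        r₀ = fromℕ< (≤-trans (s≤s z≤n) 2≤p)
        r₁ = fromℕ< 2≤p

        W : Conf G p
        W = S ∘ transpose r₀ r₁

        W-inj : Injective _≡_ _≡_ W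
        W-inj = transpose-injective r₀ r₁ ∘ S-inj

        S≉W : ¬ S ≗ W
        S≉W S≗W = 0≢1+n (trans (sym (toℕ-fromℕ< _)) (trans (cong toℕ r₀≡r₁) (toℕ-fromℕ< 2≤p)))
          where
            r₀≡r₁ : r₀ ≡ r₁
            r₀≡r₁ = S-inj (trans (S≗W r₀) (cong S (transpose-matchˡ r₀ r₁)))

        via-W : Reachable G W T → Reachable G S T
        via-W W→T = ⇝⇒reachable (connected S-inj W-inj) S≉W ◅◅ W→T

        via-T : W ≗ T → Reachable G S T
        via-T W≗T = ⇝⇒reachable (connected S-inj T-inj) λ S≗T → S≉W λ i → trans (S≗T i) (sym (W≗T i))

    _⇌_ : Conf G p → Conf G p → Set
    X ⇌ Y = X ⇝ Y × Y ⇝ X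

    ⇌-sym : ∀ {X Y} → X ⇌ Y → Y ⇌ X
    ⇌-sym (X⇝Y , Y⇝X) = Y⇝X , X⇝Y

    ⇌-trans : ∀ {X Y Z} → X ⇌ Y → Y ⇌ Z → X ⇌ Z
    ⇌-trans (X⇝Y , Y⇝X) (Y⇝Z , Z⇝Y) = X⇝Y ◅◅ Y⇝Z , Z⇝Y ◅◅ Y⇝X

    ≗⇒⇌ : ∀ {X Y} → X ≗ Y → X ⇌ Y
    ≗⇒⇌ X≗Y = ≗⇒⇝ X≗Y , ≗⇒⇝ (sym ∘ X≗Y)

    edgeMove : ∀ {S S′ : Conf G p} {a c} → Adj G a c → (∀ i → S i ≢ c) → (∀ i → S′ i ≢ a) →
               (∀ i → S i ≢ a → S′ i ≡ S i) → (∀ i → S i ≡ a → S′ i ≡ c) → PathMove G S S′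
    edgeMove {S} {S′} {a} {c} a~c c-free a-free off on =
      1 , u , u-inj , u-adj , c-free , a-free , (λ i off′ → off i (off′ fzero)) , on′
      where
        u : Fin 2 → Fin n
        u fzero    = a
        u (fsuc _) = c

        u-inj : Injective _≡_ _≡_ u
        u-inj {fzero}      {fzero}      _   = refl
        u-inj {fzero}      {fsuc fzero} a≡c = contradiction a≡c (adj⇒≢ a~c)
        u-inj {fsuc fzero} {fzero}      c≡a = contradiction (sym c≡a) (adj⇒≢ a~c)
        u-inj {fsuc fzero} {fsuc fzero} _   = refl

        u-adj : ∀ (j : Fin 1) → Adj G (u (inject₁ j)) (u (fsuc j))
        u-adj fzero = a~c

        on′ : ∀ i (j : Fin 1) → S i ≡ u (inject₁ j) → S′ i ≡ u (fsuc j)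
        on′ i fzero = on i

    moveRobot : Conf G p → Fin p → Fin n → Conf G p
    moveRobot S i c = updateAt S i (const c)

    module MoveRobot {S : Conf G p} {i a c} (S-inj : Injective _≡_ _≡_ S) (Si≡a : S i ≡ a)
                     (a~c : Adj G a c) (c-free : ¬ Occupied S c) where

      moved : moveRobot S i c i ≡ c
      moved = updateAt-updates i S

      unmoved : ∀ {j} → j ≢ i → moveRobot S i c j ≡ S j
      unmoved {j} j≢i = updateAt-minimal j i S j≢i

      injective : Injective _≡_ _≡_ (moveRobot S i c)
      injective {j} {k} eq with j ≟ i | k ≟ i
      ... | yes refl | yes refl = refl
      ... | yes refl | no k≢i   = contradiction (k , trans (sym (unmoved k≢i)) (trans (sym eq) moved)) c-free
      ... | no j≢i   | yes refl = contradiction (j , trans (sym (unmoved j≢i)) (trans eq moved)) c-free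
      ... | no j≢i   | no k≢i   = S-inj (trans (sym (unmoved j≢i)) (trans eq (unmoved k≢i)))

      vacates : ¬ Occupied (moveRobot S i c) a
      vacates (j , e) with j ≟ i
      ... | yes refl = adj⇒≢ a~c (trans (sym e) moved)
      ... | no j≢i   = j≢i (S-inj (trans (trans (sym (unmoved j≢i)) e) (sym Si≡a)))

      unchanged : ∀ {v} → v ≢ a → v ≢ c → Occupied S v ⇔ Occupied (moveRobot S i c) v
      unchanged {v} v≢a v≢c = mk⇔ to from
        where
          to : Occupied S v → Occupied (moveRobot S i c) v
          to (j , Sj≡v) = j , trans (unmoved j≢i) Sj≡v
            where
              j≢i : j ≢ i
              j≢i refl = v≢a (trans (sym Sj≡v) Si≡a)
          from : Occupied (moveRobot S i c) v → Occupied S v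
          from (j , Mj≡v) = j , trans (sym (unmoved j≢i)) Mj≡v
            where
              j≢i : j ≢ i
              j≢i refl = v≢c (trans (sym Mj≡v) moved)

      pathMove : PathMove G S (moveRobot S i c)
      pathMove = edgeMove a~c (λ j Sj≡c → c-free (j , Sj≡c)) (λ j e → vacates (j , e)) off on
        where
          off : ∀ j → S j ≢ a → moveRobot S i c j ≡ S j
          off j Sj≢a = unmoved λ { refl → Sj≢a Si≡a }
          on : ∀ j → S j ≡ a → moveRobot S i c j ≡ c
          on j Sj≡a = subst (λ k → moveRobot S i c k ≡ c) (sym (S-inj (trans Sj≡a (sym Si≡a)))) moved

    record Relocation (S : Conf G p) (a b : Fin n) : Set where
      field
        result    : Conf G p
        injective : Injective _≡_ _≡_ result
        connected : S ⇌ result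
        vacated   : ¬ Occupied result a
        occupied  : Occupied result b
        unchanged : ∀ {v} → v ≢ a → v ≢ b → Occupied S v ⇔ Occupied result v

    open Relocation

    slide : ∀ {S a c} → Injective _≡_ _≡_ S → Occupied S a → Adj G a c → ¬ Occupied S c →
            Relocation S a c
    slide {S} {a} {c} S-inj (i , Si≡a) a~c c-free = record
      { result    = moveRobot S i c
      ; injective = M.injective
      ; connected = (inj₂ (path M.pathMove) ◅ ε) , (inj₂ (path back.pathMove) ◅ inj₁ restored ◅ ε)
      ; vacated   = M.vacates
      ; occupied  = i , M.moved
      ; unchanged = M.unchanged
      }
      where
        module M = MoveRobot S-inj Si≡a a~c c-free
        module back = MoveRobot M.injective M.moved (trans (adj-sym _ _) a~c) M.vacates

        restored : moveRobot (moveRobot S i c) i a ≗ S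
        restored j with j ≟ i
        ... | yes refl = trans back.moved (sym Si≡a)
        ... | no j≢i   = trans (back.unmoved j≢i) (M.unmoved j≢i)

    relocate-via-free : ∀ {S a w b} → ¬ Occupied S w → a ≢ w → a ≢ b →
                        (R : Relocation S a w) → Relocation (result R) w b → Relocation S a b
    relocate-via-free {S} {a} {w} {b} w-free a≢w a≢b R R′ = record
      { result    = result R′
      ; injective = injective R′
      ; connected = ⇌-trans (connected R) (connected R′)
      ; vacated   = vacated R ∘ Equivalence.from (unchanged R′ a≢w a≢b)
      ; occupied  = occupied R′
      ; unchanged = unchanged′
      }
      where
        unchanged′ : ∀ {v} → v ≢ a → v ≢ b → Occupied S v ⇔ Occupied (result R′) v
        unchanged′ {v} v≢a v≢b with v ≟ w
        ... | yes refl = mk⇔ (λ occ → contradiction occ w-free) (λ occ → contradiction occ (vacated R′))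
        ... | no v≢w   = ⇔-trans (unchanged R v≢a v≢w) (unchanged R′ v≢w v≢b)

    relocate-via-occupied : ∀ {S a w b} → Occupied S w → a ≢ b → w ≢ b →
                            (R : Relocation S w b) → Relocation (result R) a w → Relocation S a b
    relocate-via-occupied {S} {a} {w} {b} w-occ a≢b w≢b R R′ = record
      { result    = result R′
      ; injective = injective R′
      ; connected = ⇌-trans (connected R) (connected R′)
      ; vacated   = vacated R′
      ; occupied  = Equivalence.to (unchanged R′ (a≢b ∘ sym) (w≢b ∘ sym)) (occupied R)
      ; unchanged = unchanged′
      }
      where
        unchanged′ : ∀ {v} → v ≢ a → v ≢ b → Occupied S v ⇔ Occupied (result R′) v
        unchanged′ {v} v≢a v≢b with v ≟ w
        ... | yes refl = mk⇔ (const (occupied R′)) (const w-occ)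
        ... | no v≢w   = ⇔-trans (unchanged R v≢w v≢b) (unchanged R′ v≢a v≢w)

    -- moving along the walk, either the next vertex is free and the robot steps onto it,
    -- or it is occupied and its robot is first relocated further along the walk
    relocate : ∀ {a b} → Walk G a b → ∀ {S} → Injective _≡_ _≡_ S → Occupied S a → ¬ Occupied S b →
               Relocation S a b
    relocate here _ a-occ b-free = contradiction a-occ b-free
    relocate {a} {b} (step {v = w} a~w w⇝b) {S} S-inj a-occ b-free with occupied? S w | w ≟ b
    ... | no w-free | yes refl = slide S-inj a-occ a~w w-free
    ... | no w-free | no w≢b   =
      relocate-via-free w-free (adj⇒≢ a~w) a≢b R (relocate w⇝b (injective R) (occupied R) b-still-free)
      where
        a≢b : a ≢ b
        a≢b = occupied⇒≢ a-occ b-free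

        R : Relocation S a w
        R = slide S-inj a-occ a~w w-free

        b-still-free : ¬ Occupied (result R) b
        b-still-free = b-free ∘ Equivalence.from (unchanged R (a≢b ∘ sym) (w≢b ∘ sym))
    ... | yes w-occ | _ =
      relocate-via-occupied w-occ a≢b (occupied⇒≢ w-occ b-free) R
        (slide (injective R) a-still-occ a~w (vacated R))
      where
        a≢b : a ≢ b
        a≢b = occupied⇒≢ a-occ b-free

        R : Relocation S w b
        R = relocate w⇝b S-inj w-occ b-free

        a-still-occ : Occupied (result R) a
        a-still-occ = Equivalence.to (unchanged R (adj⇒≢ a~w) a≢b) a-occ

    occupy : Connected G → ∀ (vs : List (Fin n)) → length vs ≤ p → ∀ {S} → Injective _≡_ _≡_ S →
             ∃ λ S′ → Injective _≡_ _≡_ S′ × S ⇌ S′ × (∀ {v} → v ∈ vs → Occupied S′ v)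
    occupy conn []       _    S-inj = _ , S-inj , (ε , ε) , λ ()
    occupy conn (v ∷ vs) vs<p S-inj with occupy conn vs (<⇒≤ vs<p) S-inj
    ... | S₁ , S₁-inj , S⇌S₁ , vs-occ with occupied? S₁ v
    ...   | yes v-occ  = S₁ , S₁-inj , S⇌S₁ , λ { (here refl) → v-occ ; (there u∈vs) → vs-occ u∈vs }
    ...   | no v-free = result R , injective R , ⇌-trans S⇌S₁ (connected R) , all-occ
      where
        off-vs : ∃ λ r → S₁ r ∉ vs
        off-vs = ∃-image-∉ _≟_ S₁-inj vs<p

        r : Fin p
        r = proj₁ off-vs

        R : Relocation S₁ (S₁ r) v
        R = relocate (conn (S₁ r) v) S₁-inj (r , refl) v-free

        all-occ : ∀ {u} → u ∈ v ∷ vs → Occupied (result R) u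
        all-occ (here refl)  = occupied R
        all-occ (there u∈vs) = Equivalence.to (unchanged R u≢S₁r (occupied⇒≢ u-occ v-free)) u-occ
          where
            u-occ : Occupied S₁ _
            u-occ = vs-occ u∈vs

            u≢S₁r : _ ≢ S₁ r
            u≢S₁r u≡S₁r = proj₂ off-vs (subst (_∈ vs) u≡S₁r u∈vs)

  module _ (conn : Connected G) {p : ℕ} (p≤n : p ≤ n) where

    gather : ∀ {S} → Injective _≡_ _≡_ S → ∃ λ σ → Injective _≡_ _≡_ σ × S ⇌ S-I G p≤n ∘ σ
    gather S-inj with occupy conn (tabulate (S-I G p≤n)) (≤-reflexive (length-tabulate _)) S-inj
    ... | S′ , _ , S⇌S′ , targets-occ = σ , σ-inj , ⇌-trans S⇌S′ (≗⇒⇌ S′≗S-I∘σ)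
      where
        robotAt : Fin p → Fin p
        robotAt k = proj₁ (targets-occ (∈-tabulate⁺ k))

        robotAt-correct : ∀ k → S′ (robotAt k) ≡ S-I G p≤n k
        robotAt-correct k = proj₂ (targets-occ (∈-tabulate⁺ k))

        robotAt-inj : Injective _≡_ _≡_ robotAt
        robotAt-inj {k} {l} eq =
          S-I-injective conn p≤n (trans (sym (robotAt-correct k)) (trans (cong S′ eq) (robotAt-correct l)))

        σ : Fin p → Fin p
        σ i = proj₁ (injective⇒strictlySurjective robotAt-inj i)

        robotAt∘σ : ∀ i → robotAt (σ i) ≡ i
        robotAt∘σ i = proj₂ (injective⇒strictlySurjective robotAt-inj i)

        σ-inj : Injective _≡_ _≡_ σ
        σ-inj {i} {j} eq = trans (sym (robotAt∘σ i)) (trans (cong robotAt eq) (robotAt∘σ j))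

        S′≗S-I∘σ : S′ ≗ S-I G p≤n ∘ σ
        S′≗S-I∘σ i = trans (cong S′ (sym (robotAt∘σ i))) (robotAt-correct (σ i))

    module _ (adjacent-swaps : ∀ (t t+1 : Fin p) → toℕ t+1 ≡ suc (toℕ t) →
                               Reachable G (S-I G p≤n) (S-π G p≤n (transpose t t+1))) where

      S-I∘σ⇌S-I : ∀ {σ} → Injective _≡_ _≡_ σ → S-I G p≤n ∘ σ ⇌ S-I G p≤n
      S-I∘σ⇌S-I = adjacentTransposition-induction (λ σ → S-I G p≤n ∘ σ ⇌ S-I G p≤n)
                    (λ σ≗id → ≗⇒⇌ (cong (S-I G p≤n) ∘ σ≗id)) swap
        where
          swap : ∀ {σ} → Injective _≡_ _≡_ σ → ∀ t t+1 → toℕ t+1 ≡ suc (toℕ t) →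
                 S-I G p≤n ∘ transpose t t+1 ∘ σ ⇌ S-I G p≤n → S-I G p≤n ∘ σ ⇌ S-I G p≤n
          swap {σ} σ-inj t t+1 adjacent = ⇌-trans (forth , back)
            where
              τ : Fin p → Fin p
              τ = transpose t t+1

              swap-once : S-I G p≤n ⇝ S-I G p≤n ∘ τ
              swap-once = reachable⇒⇝ (adjacent-swaps t t+1 adjacent)

              forth : S-I G p≤n ∘ σ ⇝ S-I G p≤n ∘ τ ∘ σ
              forth = ⇝-relabel (injective⇒strictlySurjective σ-inj) swap-once

              τσ-surj : StrictlySurjective _≡_ (τ ∘ σ)
              τσ-surj = injective⇒strictlySurjective (σ-inj ∘ transpose-injective t t+1)

              back : S-I G p≤n ∘ τ ∘ σ ⇝ S-I G p≤n ∘ σ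
              back = ⇝-relabel τσ-surj swap-once
                     ◅◅ ≗⇒⇝ (λ i → cong (S-I G p≤n) (transpose-involutive t t+1 (σ i)))

      injective⇌S-I : ∀ {S} → Injective _≡_ _≡_ S → S ⇌ S-I G p≤n
      injective⇌S-I S-inj = let σ , σ-inj , S⇌S-I∘σ = gather S-inj in ⇌-trans S⇌S-I∘σ (S-I∘σ⇌S-I σ-inj)

lemma18 : ∀ {n} (G : Graph n) → Connected G → (p : ℕ) → 2 ≤ p → (p≤n : p ≤ n) →
          UniversallySolvable G p ⇔
          (∀ (t t+1 : Fin p) → toℕ t+1 ≡ suc (toℕ t) →
             Reachable G (S-I G p≤n) (S-π G p≤n (transpose t t+1)))
lemma18 G conn p 2≤p p≤n = mk⇔ necessary sufficient
  where
    AdjacentSwapsReachable : Set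
    AdjacentSwapsReachable = ∀ (t t+1 : Fin p) → toℕ t+1 ≡ suc (toℕ t) →
                             Reachable G (S-I G p≤n) (S-π G p≤n (transpose t t+1))

    S-I-inj : Injective _≡_ _≡_ (S-I G p≤n)
    S-I-inj = S-I-injective G conn p≤n

    necessary : UniversallySolvable G p → AdjacentSwapsReachable
    necessary solvable t t+1 _ = solvable _ _ S-I-inj (transpose-injective t t+1 ∘ S-I-inj)

    sufficient : AdjacentSwapsReachable → UniversallySolvable G p
    sufficient adjacent-swaps = ⇝-connected⇒universallySolvable G 2≤p λ S-inj T-inj →
      proj₁ (⇌-trans G (S⇌S-I S-inj) (⇌-sym G (S⇌S-I T-inj)))
      where
        S⇌S-I : ∀ {S} → Injective _≡_ _≡_ S → _⇌_ G S (S-I G p≤n)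
        S⇌S-I = injective⇌S-I G conn p≤n adjacent-swaps
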